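{- Let $U$ be finite, $\mathcal{M}=(U,\mathcal{F})$ a matroid whose bases have size $s\ge1$, and $f:2^U\to\mathbb{R}$ a normalized, non-negative, monotone, weakly submodular function. Let $S$ and $O$ be bases, $A=O\cap S$, $B=S\setminus A=\{b_1,\dots,b_t\}$, $C=O\setminus A$, and let $g:B\to C$ be a bijection with $(S\setminus\{b\})\cup\{g(b)\}\in\mathcal{F}$ for all $b\in B$. Let $b'_1,\dots,b'_t$ be an ordering of $B$ such that, with $c'_i=g(b'_i)$, the sum $\sum_{i=1}^t(s-i)\left(\frac{s+1}{s}\right)^{i-1}f(S\cup\{c'_i\})$ is maximal among all orderings. Then $$\sum_{i=1}^t(s-i)\Big(\tfrac{s+1}{s}\Big)^{i-1}f(S\cup\{c'_i\})\le s f(S)+\sum_{i=1}^t(s+1-i)\Big(\tfrac{s+1}{s}\Big)^{i-1}f\big((S\cup\{c'_i\})\setminus\{b'_i\}\big)-(s+1)\Big(\tfrac{s+1}{s}\Big)^{t-1}f\big(S\setminus\{b'_1,\dots,b'_t\}\big).$$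
   Context: A normalized ($f(\emptyset)=0$), non-negative set function $f$ on $U$ is weakly submodular if for all $X,Y\subseteq U$: $|Y|f(X)+|X|f(Y)\ge |X\cap Y|\,f(X\cup Y)+|X\cup Y|\,f(X\cap Y)$; monotone means $X\subseteq Y\Rightarrow f(X)\le f(Y)$. Such a bijection $g$ exists by the matroid basis exchange property. -}

module Defs where

open import Level using (Level; _⊔_) renaming (suc to lsuc)
open import Data.Nat using (ℕ; zero; suc; _∸_)
import Data.Nat as ℕ
import Data.Fin as Fin
open import Data.Fin using (Fin; zero; suc; toℕ)
open import Data.Fin.Subset using (Subset; _∈_; _∉_; _⊆_; _∪_; _∩_; _─_; _-_; ⁅_⁆; ∣_∣; ⊥)
open import Data.Product using (Σ; ∃; _×_; _,_)
open import Relation.Nullary using (¬_)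
open import Relation.Binary.PropositionalEquality using (_≡_)
open import Relation.Binary using (Rel; IsTotalOrder)
open import Algebra.Bundles using (CommutativeRing)
open import Function.Definitions using (Injective)

-- Ordered fields (the reals are one instance).  The inverse is total,
-- with the inverse law only for non-zero elements.

record OrderedField (c ℓ₁ ℓ₂ : Level) : Set (lsuc (c ⊔ ℓ₁ ⊔ ℓ₂)) where
  field
    commutativeRing : CommutativeRing c ℓ₁
  open CommutativeRing commutativeRing public
  field
    _≤_          : Rel Carrier ℓ₂
    isTotalOrder : IsTotalOrder _≈_ _≤_
    +-monoˡ-≤    : ∀ {x y} z → x ≤ y → (x + z) ≤ (y + z)
    *-nonneg     : ∀ {x y} → 0# ≤ x → 0# ≤ y → 0# ≤ (x * y)
    0≉1          : ¬ (0# ≈ 1#)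
    _⁻¹          : Carrier → Carrier
    ⁻¹-inverse   : ∀ x → ¬ (x ≈ 0#) → (x * (x ⁻¹)) ≈ 1#

record Matroid (n : ℕ) : Set₁ where
  field
    Indep     : Subset n → Set
    indep-⊥   : Indep ⊥
    indep-⊆   : ∀ {X Y} → X ⊆ Y → Indep Y → Indep X
    augment   : ∀ {X Y} → Indep X → Indep Y → ∣ X ∣ Data.Nat.< ∣ Y ∣ →
                Σ (Fin n) λ y → y ∈ Y × y ∉ X × Indep (X ∪ ⁅ y ⁆)

  IsBasis : Subset n → Set
  IsBasis X = Indep X × (∀ y → y ∉ X → ¬ Indep (X ∪ ⁅ y ⁆))

-- An ordering b₁,…,b_t of a set B of size t: σ i = b_{i+1}.

IsOrdering : ∀ {n t} → Subset n → (Fin t → Fin n) → Set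
IsOrdering B σ = Injective _≡_ _≡_ σ × (∀ i → σ i ∈ B) × (∀ b → b ∈ B → ∃ λ i → σ i ≡ b)

-- g is a bijection from B onto C (only its values on B matter)
IsBijectionOnto : ∀ {n} → (Fin n → Fin n) → Subset n → Subset n → Set
IsBijectionOnto g B C =
  (∀ b → b ∈ B → g b ∈ C) ×
  (∀ b b′ → b ∈ B → b′ ∈ B → g b ≡ g b′ → b ≡ b′) ×
  (∀ c → c ∈ C → ∃ λ b → b ∈ B × g b ≡ c)

module _ {c ℓ₁ ℓ₂} (F : OrderedField c ℓ₁ ℓ₂) where
  open OrderedField F using (Carrier; _≈_; _≤_; _+_; _*_; 0#; 1#; _⁻¹)

  ι : ℕ → Carrier
  ι zero    = 0#
  ι (suc k) = 1# + ι k

  pow : Carrier → ℕ → Carrier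
  pow x zero    = 1#
  pow x (suc k) = x * pow x k

  -- r^(k-1) for natural k, with r^(-1) = r ⁻¹ when k = 0
  powPred : Carrier → ℕ → Carrier
  powPred x zero    = x ⁻¹
  powPred x (suc k) = pow x k

  ΣFin : ∀ {t} → (Fin t → Carrier) → Carrier
  ΣFin {ℕ.zero}  h = 0#
  ΣFin {suc t} h = h Fin.zero + ΣFin (λ i → h (Fin.suc i))

  module _ {n : ℕ} (f : Subset n → Carrier) where
    Normalized : Set ℓ₁
    Normalized = f ⊥ ≈ 0#

    NonNegative : Set ℓ₂
    NonNegative = ∀ X → 0# ≤ f X

    Monotone : Set ℓ₂
    Monotone = ∀ X Y → X ⊆ Y → f X ≤ f Y

    WeaklySubmodular : Set ℓ₂
    WeaklySubmodular = ∀ X Y →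
      ((ι ∣ X ∩ Y ∣ * f (X ∪ Y)) + (ι ∣ X ∪ Y ∣ * f (X ∩ Y)))
        ≤ ((ι ∣ Y ∣ * f X) + (ι ∣ X ∣ * f Y))

    LHSsum : (s : ℕ) (r : Carrier) (S : Subset n) (g : Fin n → Fin n) {t : ℕ} → (Fin t → Fin n) → Carrier
    LHSsum s r S g σ = ΣFin (λ k → (ι (s ∸ suc (toℕ k)) * pow r (toℕ k)) * f (S ∪ ⁅ g (σ k) ⁆))

    RHSsum : (s : ℕ) (r : Carrier) (S : Subset n) (g : Fin n → Fin n) {t : ℕ} → (Fin t → Fin n) → Carrier
    RHSsum s r S g σ = ΣFin (λ k → (ι (suc s ∸ suc (toℕ k)) * pow r (toℕ k)) * f ((S ∪ ⁅ g (σ k) ⁆) - σ k))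

  ratio : ℕ → Carrier
  ratio s = ι (suc s) * (ι s ⁻¹)

-- Let D_k be S with its first k exchanged elements b'_1, …, b'_k removed, so D_0 = S and
-- D_t = S ∖ B.  Weak submodularity applied to X = (S ∪ {c'_i}) ∖ {b'_i} and Y = D_{i-1}, for
-- which X ∩ Y = D_i, X ∪ Y = S ∪ {c'_i}, |X| = s and |Y| = s - i + 1, gives
--   (s-i) f(S ∪ {c'_i}) + (s+1) f(D_i) ≤ (s+1-i) f(X) + s f(D_{i-1}).
-- Multiplied by r^{i-1} with r = (s+1)/s, and since (s+1) r^{i-1} = s r^i, the terms in D
-- telescope along the potential Φ_k = s r^k f(D_k), leaving s f(S) - s r^t f(S ∖ B).
module Submission where

open import Defs
open import Data.Nat as ℕ using (ℕ; zero; suc; _∸_; z≤n; s≤s)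
import Data.Nat.Properties as ℕ
open import Data.Fin using (Fin; zero; suc; toℕ; _≟_)
open import Data.Fin.Properties using (toℕ<n; 0≢1+n; suc-injective)
open import Data.Vec using (_∷_; here; there)
open import Data.Product using (_×_; _,_; proj₂)
open import Data.Sum using (inj₁; inj₂)
open import Data.Empty using (⊥-elim)
open import Function using (_∘_)
open import Function.Definitions using (Injective)
open import Relation.Nullary using (yes; no)
open import Relation.Binary.PropositionalEquality
  using (_≡_; _≢_; refl; cong; sym; trans; subst)
open import Relation.Binary.Structures using (IsTotalOrder)

module OrderedFieldProperties {c ℓ₁ ℓ₂} (F : OrderedField c ℓ₁ ℓ₂) where

  open OrderedField F hiding (zero; refl; sym; trans; _≤_)
  open OrderedField F using () renaming (_≤_ to infix 4 _≤_)
  open OrderedField F using () renaming (refl to ≈-refl; sym to ≈-sym; trans to ≈-trans)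
  open IsTotalOrder isTotalOrder using (total; antisym; ≤-respˡ-≈; ≤-respʳ-≈)
    renaming (refl to ≤-refl; trans to ≤-trans)
  open import Algebra.Properties.Ring ring using (-‿distribˡ-*; -‿distribʳ-*; -‿involutive)
  open import Algebra.Solver.Ring.NaturalCoefficients.Default commutativeSemiring
  open import Relation.Binary.Reasoning.Setoid setoid

  ≤-resp-≈ : ∀ {a b x y} → a ≈ x → b ≈ y → a ≤ b → x ≤ y
  ≤-resp-≈ a≈x b≈y = ≤-respʳ-≈ b≈y ∘ ≤-respˡ-≈ a≈x

  +-monoʳ-≤ : ∀ {x y} z → x ≤ y → z + x ≤ z + y
  +-monoʳ-≤ z = ≤-resp-≈ (+-comm _ z) (+-comm _ z) ∘ +-monoˡ-≤ z

  +-mono-≤ : ∀ {a b x y} → a ≤ b → x ≤ y → a + x ≤ b + y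
  +-mono-≤ {b = b} {x = x} a≤b x≤y = ≤-trans (+-monoˡ-≤ x a≤b) (+-monoʳ-≤ b x≤y)

  x+y-y≈x : ∀ x y → x + y - y ≈ x
  x+y-y≈x x y = ≈-trans (+-assoc x y (- y)) (≈-trans (+-congˡ (-‿inverseʳ y)) (+-identityʳ x))

  x+y≤z⇒x≤z-y : ∀ {x y z} → x + y ≤ z → x ≤ z - y
  x+y≤z⇒x≤z-y {x} {y} = ≤-resp-≈ (x+y-y≈x x y) ≈-refl ∘ +-monoˡ-≤ (- y)

  x≤y⇒0≤y-x : ∀ {x y} → x ≤ y → 0# ≤ y - x
  x≤y⇒0≤y-x {x} = ≤-resp-≈ (-‿inverseʳ x) ≈-refl ∘ +-monoˡ-≤ (- x)

  0≤y-x⇒x≤y : ∀ {x y} → 0# ≤ y - x → x ≤ y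
  0≤y-x⇒x≤y {x} {y} = ≤-resp-≈ (+-identityˡ x) (≈-trans (+-assoc y (- x) x)
    (≈-trans (+-congˡ (-‿inverseˡ x)) (+-identityʳ y))) ∘ +-monoˡ-≤ x

  *-monoˡ-≤-nonneg : ∀ {x y} p → 0# ≤ p → x ≤ y → x * p ≤ y * p
  *-monoˡ-≤-nonneg {x} {y} p 0≤p x≤y = 0≤y-x⇒x≤y (≤-resp-≈ ≈-refl [y-x]p≈yp-xp
    (*-nonneg (x≤y⇒0≤y-x x≤y) 0≤p))
    where
    [y-x]p≈yp-xp : (y - x) * p ≈ y * p - x * p
    [y-x]p≈yp-xp = ≈-trans (distribʳ p y (- x)) (+-congˡ (≈-sym (-‿distribˡ-* x p)))

  x*x-nonneg : ∀ x → 0# ≤ x * x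
  x*x-nonneg x with total 0# x
  ... | inj₁ 0≤x = *-nonneg 0≤x 0≤x
  ... | inj₂ x≤0 = ≤-resp-≈ ≈-refl -x*-x≈x*x (*-nonneg 0≤-x 0≤-x)
    where
    0≤-x : 0# ≤ - x
    0≤-x = ≤-resp-≈ ≈-refl (+-identityˡ (- x)) (x≤y⇒0≤y-x x≤0)
    -x*-x≈x*x : - x * - x ≈ x * x
    -x*-x≈x*x = begin
      - x * - x      ≈⟨ -‿distribˡ-* x (- x) ⟨
      - (x * - x)    ≈⟨ -‿cong (-‿distribʳ-* x x) ⟨
      - (- (x * x))  ≈⟨ -‿involutive (x * x) ⟩
      x * x          ∎

  0≤1 : 0# ≤ 1#
  0≤1 = ≤-resp-≈ ≈-refl (*-identityˡ 1#) (x*x-nonneg 1#)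

  ι-nonneg : ∀ k → 0# ≤ ι F k
  ι-nonneg zero    = ≤-refl
  ι-nonneg (suc k) = ≤-resp-≈ (+-identityˡ 0#) ≈-refl (+-mono-≤ 0≤1 (ι-nonneg k))

  ι-suc≉0 : ∀ k → ι F (suc k) ≉ 0#
  ι-suc≉0 k 1+k≈0 = 0≉1 (antisym 0≤1 1≤0)
    where
    1≤0 : 1# ≤ 0#
    1≤0 = ≤-resp-≈ (+-identityʳ 1#) 1+k≈0 (+-monoʳ-≤ 1# (ι-nonneg k))

  ⁻¹-nonneg : ∀ {x} → 0# ≤ x → x ≉ 0# → 0# ≤ x ⁻¹
  ⁻¹-nonneg {x} 0≤x x≉0 = ≤-resp-≈ ≈-refl x[x⁻¹x⁻¹]≈x⁻¹ (*-nonneg 0≤x (x*x-nonneg (x ⁻¹)))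
    where
    x[x⁻¹x⁻¹]≈x⁻¹ : x * (x ⁻¹ * x ⁻¹) ≈ x ⁻¹
    x[x⁻¹x⁻¹]≈x⁻¹ = begin
      x * (x ⁻¹ * x ⁻¹)  ≈⟨ *-assoc x (x ⁻¹) (x ⁻¹) ⟨
      x * x ⁻¹ * x ⁻¹    ≈⟨ *-congʳ (⁻¹-inverse x x≉0) ⟩
      1# * x ⁻¹          ≈⟨ *-identityˡ (x ⁻¹) ⟩
      x ⁻¹               ∎

  pow-nonneg : ∀ {r} → 0# ≤ r → ∀ k → 0# ≤ pow F r k
  pow-nonneg 0≤r zero    = 0≤1
  pow-nonneg 0≤r (suc k) = *-nonneg 0≤r (pow-nonneg 0≤r k)

  telescope : ∀ {t} (a b : Fin t → Carrier) (T : ℕ → Carrier) →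
              (∀ i → a i ≤ b i + (T (toℕ i) - T (suc (toℕ i)))) →
              ΣFin F a ≤ ΣFin F b + (T 0 - T t)
  telescope {zero} a b T _ =
    ≤-resp-≈ ≈-refl (≈-sym (≈-trans (+-identityˡ _) (-‿inverseʳ (T 0)))) ≤-refl
  telescope {suc t} a b T step = ≤-resp-≈ ≈-refl regroup
    (+-mono-≤ (step zero) (telescope (a ∘ suc) (b ∘ suc) (T ∘ suc) (step ∘ suc)))
    where
    regroup : b zero + (T 0 - T 1) + (ΣFin F (b ∘ suc) + (T 1 - T (suc t)))
              ≈ ΣFin F b + (T 0 - T (suc t))
    regroup = begin
      b zero + (T 0 - T 1) + (ΣFin F (b ∘ suc) + (T 1 - T (suc t)))
        ≈⟨ solve 6 (λ b₀ bs t₀ -t₁ t₁ -tₜ →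
                      (b₀ :+ (t₀ :+ -t₁)) :+ (bs :+ (t₁ :+ -tₜ))
                   := ((b₀ :+ bs) :+ (t₀ :+ -tₜ)) :+ (t₁ :+ -t₁))
                 ≈-refl (b zero) (ΣFin F (b ∘ suc)) (T 0) (- T 1) (T 1) (- T (suc t)) ⟩
      ΣFin F b + (T 0 - T (suc t)) + (T 1 - T 1)
        ≈⟨ +-congˡ (-‿inverseʳ (T 1)) ⟩
      ΣFin F b + (T 0 - T (suc t)) + 0#
        ≈⟨ +-identityʳ _ ⟩
      ΣFin F b + (T 0 - T (suc t)) ∎

  -- Multiply by p ≥ 0 and move the e-term to the right, writing e p = d (r p).
  scale-rearrange : ∀ {a c d e r p x y z w} → d * r ≈ e → 0# ≤ p →
    a * x + e * y ≤ c * z + d * w →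
    a * p * x ≤ c * p * z + (d * (p * w) - d * (r * p * y))
  scale-rearrange {a} {c} {d} {e} {r} {p} {x} {y} {z} {w} dr≈e 0≤p ineq =
    ≤-resp-≈ ≈-refl rhs≈ (x+y≤z⇒x≤z-y (≤-resp-≈ lhs≈ ≈-refl (*-monoˡ-≤-nonneg p 0≤p ineq)))
    where
    lhs≈ : (a * x + e * y) * p ≈ a * p * x + d * (r * p * y)
    lhs≈ = begin
      (a * x + e * y) * p        ≈⟨ *-congʳ (+-congˡ (*-congʳ (≈-sym dr≈e))) ⟩
      (a * x + d * r * y) * p    ≈⟨ solve 6 (λ a x d r y p →
                                       ((a :* x) :+ ((d :* r) :* y)) :* p
                                    := ((a :* p) :* x) :+ (d :* ((r :* p) :* y)))
                                    ≈-refl a x d r y p ⟩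
      a * p * x + d * (r * p * y) ∎
    rhs≈ : (c * z + d * w) * p - d * (r * p * y) ≈ c * p * z + (d * (p * w) - d * (r * p * y))
    rhs≈ = solve 6 (λ c z d w p m → (((c :* z) :+ (d :* w)) :* p) :+ m
                                  := ((c :* p) :* z) :+ ((d :* (p :* w)) :+ m))
             ≈-refl c z d w p (- (d * (r * p * y)))

  -- For bases of size suc s: d = s, e = s + 1 and r = (s + 1) / s in the paper's notation.
  module Ratio (s : ℕ) where

    d : Carrier
    d = ι F (suc s)

    e : Carrier
    e = ι F (suc (suc s))

    r : Carrier
    r = ratio F (suc s)

    d*r≈e : d * r ≈ e
    d*r≈e = begin
      d * (e * d ⁻¹)  ≈⟨ solve 3 (λ d e d⁻¹ → d :* (e :* d⁻¹) := e :* (d :* d⁻¹)) ≈-refl d e (d ⁻¹) ⟩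
      e * (d * d ⁻¹)  ≈⟨ *-congˡ (⁻¹-inverse d (ι-suc≉0 s)) ⟩
      e * 1#          ≈⟨ *-identityʳ e ⟩
      e               ∎

    r-nonneg : 0# ≤ r
    r-nonneg = *-nonneg (ι-nonneg (suc (suc s))) (⁻¹-nonneg (ι-nonneg (suc s)) (ι-suc≉0 s))

    r≉0 : r ≉ 0#
    r≉0 r≈0 = ι-suc≉0 (suc s) (≈-trans (≈-sym d*r≈e) (≈-trans (*-congˡ r≈0) (zeroʳ d)))

    e*powPred≈d*pow : ∀ t → e * powPred F r t ≈ d * pow F r t
    e*powPred≈d*pow zero = begin
      e * r ⁻¹        ≈⟨ *-congʳ (≈-sym d*r≈e) ⟩
      d * r * r ⁻¹    ≈⟨ *-assoc d r (r ⁻¹) ⟩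
      d * (r * r ⁻¹)  ≈⟨ *-congˡ (⁻¹-inverse r r≉0) ⟩
      d * 1#          ∎
    e*powPred≈d*pow (suc t) = ≈-trans (*-congʳ (≈-sym d*r≈e)) (*-assoc d r (pow F r t))

open import Data.Fin.Subset
  using (Subset; _∈_; _∉_; _⊆_; _∪_; _∩_; _─_; _-_; ⁅_⁆; ∣_∣; inside; outside)
open import Data.Fin.Subset.Properties
  using ( ⊆-antisym; x∈⁅x⁆; p─⊥≡p; ∪-identityʳ; p⊆p∪q; q⊆p∪q; x∈p∪q⁻; x∈p∩q⁺; x∈p∩q⁻
        ; p─q⊆p; x∈p∧x∉q⇒x∈p─q; x∈p∧x≢y⇒x∈p-y)

x∈p─q⁻ : ∀ {n} (p q : Subset n) {x} → x ∈ p ─ q → x ∈ p × x ∉ q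
x∈p─q⁻ (inside ∷ p)  (outside ∷ q) here      = here , λ ()
x∈p─q⁻ (inside ∷ p)  (inside ∷ q)  {zero} ()
x∈p─q⁻ (outside ∷ p) (inside ∷ q)  {zero} ()
x∈p─q⁻ (outside ∷ p) (outside ∷ q) {zero} ()
x∈p─q⁻ (_ ∷ p)       (_ ∷ q)       (there x∈) with x∈p─q⁻ p q x∈
... | x∈p , x∉q = there x∈p , λ { (there x∈q) → x∉q x∈q }

x∈p─p∩q⇒x∉q : ∀ {n} {p q : Subset n} {x} → x ∈ p ─ (p ∩ q) → x ∉ q
x∈p─p∩q⇒x∉q {p = p} {q} x∈ x∈q with x∈p─q⁻ p (p ∩ q) x∈
... | x∈p , x∉p∩q = x∉p∩q (x∈p∩q⁺ (x∈p , x∈q))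

x∈p⇒suc∣p-x∣≡∣p∣ : ∀ {n} {p : Subset n} {x} → x ∈ p → suc ∣ p - x ∣ ≡ ∣ p ∣
x∈p⇒suc∣p-x∣≡∣p∣ {p = inside ∷ p}  here       = cong (suc ∘ ∣_∣) (p─⊥≡p p)
x∈p⇒suc∣p-x∣≡∣p∣ {p = inside ∷ p}  (there x∈) = cong suc (x∈p⇒suc∣p-x∣≡∣p∣ x∈)
x∈p⇒suc∣p-x∣≡∣p∣ {p = outside ∷ p} (there x∈) = x∈p⇒suc∣p-x∣≡∣p∣ x∈

x∉p⇒∣p∪⁅x⁆∣≡suc∣p∣ : ∀ {n} {p : Subset n} {x} → x ∉ p → ∣ p ∪ ⁅ x ⁆ ∣ ≡ suc ∣ p ∣
x∉p⇒∣p∪⁅x⁆∣≡suc∣p∣ {p = inside ∷ p}  {zero}  x∉ = ⊥-elim (x∉ here)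
x∉p⇒∣p∪⁅x⁆∣≡suc∣p∣ {p = outside ∷ p} {zero}  x∉ = cong (suc ∘ ∣_∣) (∪-identityʳ p)
x∉p⇒∣p∪⁅x⁆∣≡suc∣p∣ {p = inside ∷ p}  {suc x} x∉ = cong suc (x∉p⇒∣p∪⁅x⁆∣≡suc∣p∣ (x∉ ∘ there))
x∉p⇒∣p∪⁅x⁆∣≡suc∣p∣ {p = outside ∷ p} {suc x} x∉ = x∉p⇒∣p∪⁅x⁆∣≡suc∣p∣ (x∉ ∘ there)

q⊆p⇒p-x∩q≡q-x : ∀ {n} {p q : Subset n} {x} → q ⊆ p → (p - x) ∩ q ≡ q - x
q⊆p⇒p-x∩q≡q-x {p = p} {q} {x} q⊆p = ⊆-antisym ⊆q-x q-x⊆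
  where
  ⊆q-x : (p - x) ∩ q ⊆ q - x
  ⊆q-x y∈ with x∈p∩q⁻ (p - x) q y∈
  ... | y∈p-x , y∈q = x∈p∧x∉q⇒x∈p─q y∈q (proj₂ (x∈p─q⁻ p ⁅ x ⁆ y∈p-x))
  q-x⊆ : q - x ⊆ (p - x) ∩ q
  q-x⊆ y∈ with x∈p─q⁻ q ⁅ x ⁆ y∈
  ... | y∈q , y∉⁅x⁆ = x∈p∩q⁺ (x∈p∧x∉q⇒x∈p─q (q⊆p y∈q) y∉⁅x⁆ , y∈q)

q⊆p⇒x∈q⇒p-x∪q≡p : ∀ {n} {p q : Subset n} {x} → q ⊆ p → x ∈ q → (p - x) ∪ q ≡ p
q⊆p⇒x∈q⇒p-x∪q≡p {p = p} {q} {x} q⊆p x∈q = ⊆-antisym ⊆p p⊆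
  where
  ⊆p : (p - x) ∪ q ⊆ p
  ⊆p y∈ with x∈p∪q⁻ (p - x) q y∈
  ... | inj₁ y∈p-x = p─q⊆p p ⁅ x ⁆ y∈p-x
  ... | inj₂ y∈q   = q⊆p y∈q
  p⊆ : p ⊆ (p - x) ∪ q
  p⊆ {y} y∈p with y ≟ x
  ... | yes refl = q⊆p∪q (p - x) q x∈q
  ... | no y≢x   = p⊆p∪q q (x∈p∧x≢y⇒x∈p-y y∈p y≢x)

removeFirst : ∀ {n t} → (Fin t → Fin n) → ℕ → Subset n → Subset n
removeFirst             σ zero    S = S
removeFirst {t = zero}  σ (suc k) S = S
removeFirst {t = suc t} σ (suc k) S = removeFirst (σ ∘ suc) k (S - σ zero)

removeFirst-suc : ∀ {n t} (σ : Fin t → Fin n) i S →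
                  removeFirst σ (suc (toℕ i)) S ≡ removeFirst σ (toℕ i) S - σ i
removeFirst-suc σ zero    S = refl
removeFirst-suc σ (suc i) S = removeFirst-suc (σ ∘ suc) i (S - σ zero)

removeFirst⊆ : ∀ {n t} (σ : Fin t → Fin n) k S → removeFirst σ k S ⊆ S
removeFirst⊆             σ zero    S = λ x∈ → x∈
removeFirst⊆ {t = zero}  σ (suc k) S = λ x∈ → x∈
removeFirst⊆ {t = suc t} σ (suc k) S =
  p─q⊆p S ⁅ σ zero ⁆ ∘ removeFirst⊆ (σ ∘ suc) k (S - σ zero)

InjectiveInto : ∀ {n t} → Subset n → (Fin t → Fin n) → Set
InjectiveInto S σ = Injective _≡_ _≡_ σ × (∀ j → σ j ∈ S)

injectiveInto-tail : ∀ {n t} {S : Subset n} {σ : Fin (suc t) → Fin n} →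
                     InjectiveInto S σ → InjectiveInto (S - σ zero) (σ ∘ suc)
injectiveInto-tail (σ-inj , σ∈S) =
  suc-injective ∘ σ-inj , λ j → x∈p∧x≢y⇒x∈p-y (σ∈S (suc j)) (0≢1+n ∘ σ-inj ∘ sym)

σ∈removeFirst : ∀ {n t} {S : Subset n} {σ : Fin t → Fin n} →
                InjectiveInto S σ → ∀ i → σ i ∈ removeFirst σ (toℕ i) S
σ∈removeFirst (_ , σ∈S) zero    = σ∈S zero
σ∈removeFirst σ-into    (suc i) = σ∈removeFirst (injectiveInto-tail σ-into) i

∣removeFirst∣ : ∀ {n t} {S : Subset n} {σ : Fin t → Fin n} → InjectiveInto S σ →
                ∀ k → k ℕ.≤ t → ∣ removeFirst σ k S ∣ ≡ ∣ S ∣ ∸ k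
∣removeFirst∣ σ-into zero z≤n = refl
∣removeFirst∣ {t = suc t} σ-into@(_ , σ∈S) (suc k) (s≤s k≤t) =
  trans (∣removeFirst∣ (injectiveInto-tail σ-into) k k≤t)
        (cong (_∸ suc k) (x∈p⇒suc∣p-x∣≡∣p∣ (σ∈S zero)))

∈removeAll⁻ : ∀ {n t} (σ : Fin t → Fin n) S {x} → x ∈ removeFirst σ t S → ∀ j → σ j ≢ x
∈removeAll⁻ {t = suc t} σ S x∈ zero refl =
  proj₂ (x∈p─q⁻ S ⁅ σ zero ⁆ (removeFirst⊆ (σ ∘ suc) t (S - σ zero) x∈)) (x∈⁅x⁆ (σ zero))
∈removeAll⁻ σ S x∈ (suc j) = ∈removeAll⁻ (σ ∘ suc) (S - σ zero) x∈ j

∈removeAll⁺ : ∀ {n t} (σ : Fin t → Fin n) S {x} → x ∈ S → (∀ j → σ j ≢ x) →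
              x ∈ removeFirst σ t S
∈removeAll⁺ {t = zero}  σ S x∈S σ≢x = x∈S
∈removeAll⁺ {t = suc t} σ S x∈S σ≢x =
  ∈removeAll⁺ (σ ∘ suc) (S - σ zero) (x∈p∧x≢y⇒x∈p-y x∈S (σ≢x zero ∘ sym)) (σ≢x ∘ suc)

removeAll≡─ : ∀ {n t} {B : Subset n} {σ : Fin t → Fin n} S →
              IsOrdering B σ → removeFirst σ t S ≡ S ─ B
removeAll≡─ {t = t} {B} {σ} S (_ , σ∈B , σ-onto) = ⊆-antisym ⊆S─B S─B⊆
  where
  ⊆S─B : removeFirst σ t S ⊆ S ─ B
  ⊆S─B {x} x∈ = x∈p∧x∉q⇒x∈p─q (removeFirst⊆ σ t S x∈) λ x∈B →
    let j , σj≡x = σ-onto x x∈B in ∈removeAll⁻ σ S x∈ j σj≡x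
  S─B⊆ : S ─ B ⊆ removeFirst σ t S
  S─B⊆ x∈ with x∈p─q⁻ S B x∈
  ... | x∈S , x∉B = ∈removeAll⁺ σ S x∈S λ j σj≡x → x∉B (subst (_∈ B) σj≡x (σ∈B j))

module _ {c ℓ₁ ℓ₂} (F : OrderedField c ℓ₁ ℓ₂) {n} (f : Subset n → OrderedField.Carrier F) where

  open OrderedField F hiding (zero; refl; sym; trans; _≤_) renaming (_-_ to _⊖_)
  open OrderedField F using () renaming (_≤_ to infix 4 _≤_)
  open OrderedFieldProperties F

  weaklySubmodular-exchange : WeaklySubmodular F f →
    ∀ {X Y I U : Subset n} {x y i u} → X ∩ Y ≡ I → X ∪ Y ≡ U →
    ∣ X ∣ ≡ x → ∣ Y ∣ ≡ y → ∣ I ∣ ≡ i → ∣ U ∣ ≡ u →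
    ι F i * f U + ι F u * f I ≤ ι F y * f X + ι F x * f Y
  weaklySubmodular-exchange ws {X} {Y} refl refl refl refl refl refl = ws X Y

  module Potential (s : ℕ) (S : Subset n) {t} (σ : Fin t → Fin n) where

    open Ratio s
    open import Relation.Binary.Reasoning.Setoid setoid

    potential : ℕ → Carrier
    potential k = d * (pow F r k * f (removeFirst σ k S))

    exchange-step : WeaklySubmodular F f → ∣ S ∣ ≡ suc s → InjectiveInto S σ →
      ∀ i {c} → c ∉ S → let k = toℕ i in
      ι F (suc s ∸ suc k) * pow F r k * f (S ∪ ⁅ c ⁆)
        ≤ ι F (suc (suc s) ∸ suc k) * pow F r k * f ((S ∪ ⁅ c ⁆) - σ i)
          + (potential k ⊖ potential (suc k))
    exchange-step ws ∣S∣≡1+s σ-into@(_ , σ∈S) i {c} c∉S =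
      scale-rearrange d*r≈e (pow-nonneg r-nonneg k)
        (weaklySubmodular-exchange ws X∩Y≡ X∪Y≡ ∣X∣≡ ∣Y∣≡ ∣X∩Y∣≡ ∣X∪Y∣≡)
      where
      k : ℕ
      k = toℕ i
      Y⊆S∪c : removeFirst σ k S ⊆ S ∪ ⁅ c ⁆
      Y⊆S∪c = p⊆p∪q ⁅ c ⁆ ∘ removeFirst⊆ σ k S
      X∩Y≡ : ((S ∪ ⁅ c ⁆) - σ i) ∩ removeFirst σ k S ≡ removeFirst σ (suc k) S
      X∩Y≡ = trans (q⊆p⇒p-x∩q≡q-x Y⊆S∪c) (sym (removeFirst-suc σ i S))
      X∪Y≡ : ((S ∪ ⁅ c ⁆) - σ i) ∪ removeFirst σ k S ≡ S ∪ ⁅ c ⁆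
      X∪Y≡ = q⊆p⇒x∈q⇒p-x∪q≡p Y⊆S∪c (σ∈removeFirst σ-into i)
      ∣X∪Y∣≡ : ∣ S ∪ ⁅ c ⁆ ∣ ≡ suc (suc s)
      ∣X∪Y∣≡ = trans (x∉p⇒∣p∪⁅x⁆∣≡suc∣p∣ c∉S) (cong suc ∣S∣≡1+s)
      ∣X∣≡ : ∣ (S ∪ ⁅ c ⁆) - σ i ∣ ≡ suc s
      ∣X∣≡ = ℕ.suc-injective (trans (x∈p⇒suc∣p-x∣≡∣p∣ (p⊆p∪q ⁅ c ⁆ (σ∈S i))) ∣X∪Y∣≡)
      ∣Y∣≡ : ∣ removeFirst σ k S ∣ ≡ suc s ∸ k
      ∣Y∣≡ = trans (∣removeFirst∣ σ-into k (ℕ.<⇒≤ (toℕ<n i))) (cong (_∸ k) ∣S∣≡1+s)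
      ∣X∩Y∣≡ : ∣ removeFirst σ (suc k) S ∣ ≡ suc s ∸ suc k
      ∣X∩Y∣≡ = trans (∣removeFirst∣ σ-into (suc k) (toℕ<n i)) (cong (_∸ suc k) ∣S∣≡1+s)

    potential-zero : potential 0 ≈ d * f S
    potential-zero = *-congˡ (*-identityˡ (f S))

    potential-all : ∀ {B} → IsOrdering B σ → potential t ≈ e * (powPred F r t * f (S ─ B))
    potential-all {B} σ-ord = begin
      d * (pow F r t * f (removeFirst σ t S))  ≈⟨ *-congˡ (*-congˡ (reflexive (cong f (removeAll≡─ S σ-ord)))) ⟩
      d * (pow F r t * f (S ─ B))              ≈⟨ *-assoc d _ _ ⟨
      d * pow F r t * f (S ─ B)                ≈⟨ *-congʳ (e*powPred≈d*pow t) ⟨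
      e * powPred F r t * f (S ─ B)            ≈⟨ *-assoc e _ _ ⟩
      e * (powPred F r t * f (S ─ B))          ∎

    potential-telescoped : ∀ R {B} → IsOrdering B σ →
      R + (potential 0 ⊖ potential t) ≈ d * f S + R ⊖ e * (powPred F r t * f (S ─ B))
    potential-telescoped R {B} σ-ord = begin
      R + (potential 0 ⊖ potential t)                   ≈⟨ +-congˡ (+-cong potential-zero (-‿cong (potential-all σ-ord))) ⟩
      R + (d * f S ⊖ e * (powPred F r t * f (S ─ B)))   ≈⟨ +-assoc R _ _ ⟨
      R + d * f S ⊖ e * (powPred F r t * f (S ─ B))     ≈⟨ +-congʳ (+-comm R _) ⟩
      d * f S + R ⊖ e * (powPred F r t * f (S ─ B))     ∎

lemma8 : ∀ {c ℓ₁ ℓ₂} (F : OrderedField c ℓ₁ ℓ₂) (n : ℕ) (M : Matroid n) (s : ℕ) →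
    (∀ X → Matroid.IsBasis M X → ∣ X ∣ ≡ s) → 1 ℕ.≤ s →
    (f : Subset n → OrderedField.Carrier F) →
    Normalized F f → NonNegative F f → Monotone F f → WeaklySubmodular F f →
    (S O : Subset n) → Matroid.IsBasis M S → Matroid.IsBasis M O →
    (g : Fin n → Fin n) →
    IsBijectionOnto g (S ─ (O ∩ S)) (O ─ (O ∩ S)) →
    (∀ b → b ∈ (S ─ (O ∩ S)) → Matroid.Indep M ((S - b) ∪ ⁅ g b ⁆)) →
    (σ : Fin ∣ S ─ (O ∩ S) ∣ → Fin n) → IsOrdering (S ─ (O ∩ S)) σ →
    (∀ (τ : Fin ∣ S ─ (O ∩ S) ∣ → Fin n) → IsOrdering (S ─ (O ∩ S)) τ →
       OrderedField._≤_ F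
         (LHSsum F f s (ratio F s) S g τ)
         (LHSsum F f s (ratio F s) S g σ)) →
    OrderedField._≤_ F
      (LHSsum F f s (ratio F s) S g σ)
      (OrderedField._-_ F
        (OrderedField._+_ F (OrderedField._*_ F (ι F s) (f S))
          (RHSsum F f s (ratio F s) S g σ))
        (OrderedField._*_ F (ι F (suc s))
          (OrderedField._*_ F
            (powPred F (ratio F s) ∣ S ─ (O ∩ S) ∣)
            (f (S ─ (S ─ (O ∩ S)))))))
lemma8 F n M (suc s) basis-size (s≤s z≤n) f _ _ _ ws S O S-basis _ g (g∈C , _) _
       σ σ-ord@(σ-inj , σ∈B , _) _ =
  ≤-resp-≈ ≈-refl (potential-telescoped _ σ-ord)
    (telescope _ _ potential λ i →
      exchange-step ws (basis-size S S-basis) σ-into i (x∈p─p∩q⇒x∉q (g∈C (σ i) (σ∈B i))))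
  where
  open OrderedField F using () renaming (refl to ≈-refl)
  open OrderedFieldProperties F
  open Potential F f s S σ

  σ-into : InjectiveInto S σ
  σ-into = σ-inj , p─q⊆p S (O ∩ S) ∘ σ∈B
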